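{- For every $(u'',\ell')\in B_{m-1,n-1}\times B_{m-1,n}$ and every $y\in\mathbb{Z}^2$, the configuration $M(u'',\ell',y)$ on $K_{m,n}$ is sorted and satisfies the compact range assumption.
   Context: $m,n$ are positive integers. $B_{p,q}$ is the set of words over $\{N,E\}$ with $p$ letters $E$ and $q$ letters $N$; words are lattice paths with $N=(0,1)$, $E=(1,0)$. For $w\in B_{p,q}$, $w^{\mathbb{Z}}$ is the bi-infinite path obtained by concatenating, for all $i\in\mathbb{Z}$, the paths from $(pi,qi)$ with step sequence $w$. Put $R=(Nu'')^{\mathbb{Z}}$ and $G=(E\ell')^{\mathbb{Z}}$. For each $i\in\mathbb{Z}$, $G$ has a unique north step whose starting point has ordinate $i$; call it $N_i$ and let $X_1(N_i)$ be the abscissa of its starting point. For each $j\in\mathbb{Z}$, $R$ has a unique east step whose starting point has abscissa $j$; call it $E_j$ and let $X_2(E_j)$ be the ordinate of its starting point. For $y=(y_1,y_2)$, $M(u'',\ell',y)=(c_1,\dots,c_{n+m-1})$ where $c_{i+1}=X_1(N_{y_2+i})-y_1-1$ for $0\le i\le n-1$ and $c_{n+1+j}=X_2(E_{y_1+j})-y_2-1$ for $0\le j\le m-2$. This is viewed as a configuration on $K_{m,n}$ (vertices $v_1,\dots,v_{n+m}$, edges between $v_i,v_j$ for $i\le n<j$, sink $v_{n+m}$; entry $c_i$ at $v_i$). A configuration is sorted if $c_1\le\dots\le c_n$ and $c_{n+1}\le\dots\le c_{n+m-1}$; it satisfies the compact range assumption if $\max_{i\le n}c_i-\min_{i\le n}c_i\le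 m$ and $\max_{n<i<n+m}c_i-\min_{n<i<n+m}c_i\le n$. -}

module Defs where

open import Data.Nat using (ℕ; zero; suc) renaming (_≤_ to _≤ℕ_; _<_ to _<ℕ_; _∸_ to _∸ℕ_; _+_ to _+ℕ_)
open import Data.Integer using (ℤ; +_; _+_; _-_; _*_; _≤_)
open import Data.Fin using (Fin; toℕ)
open import Data.List using (List; []; _∷_; length; lookup; take)
open import Data.Product using (Σ; _×_; _,_)
open import Relation.Binary.PropositionalEquality using (_≡_)

-- Letters: N = (0,1) (north step), E = (1,0) (east step).
data Letter : Set where
  N E : Letter

Word : Set
Word = List Letter

count : Letter → Word → ℕ
count a [] = 0
count N (N ∷ w) = suc (count N w)
count N (E ∷ w) = count N w
count E (E ∷ w) = suc (count E w)
count E (N ∷ w) = count E w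

InB : ℕ → ℕ → Word → Set
InB p q w = (count E w ≡ p) × (count N w ≡ q)

-- The bi-infinite path w^ℤ (w ∈ B_{p,q}): the concatenation, for all k ∈ ℤ,
-- of the path with step sequence w starting at (p k, q k).
-- 'StepOf w p q a x y' : the path w^ℤ has a step of letter a whose
-- starting point is (x , y); namely the step w[s] of the k-th copy,
-- starting at (p k + #E(w[0..s)), q k + #N(w[0..s))).
StepOf : Word → ℕ → ℕ → Letter → ℤ → ℤ → Set
StepOf w p q a x y =
  Σ ℤ λ k → Σ (Fin (length w)) λ s →
    (lookup w s ≡ a)
    × (x ≡ (+ p) * k + + count E (take (toℕ s) w))
    × (y ≡ (+ q) * k + + count N (take (toℕ s) w))

RPath GPath : ℕ → ℕ → Word → Letter → ℤ → ℤ → Set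
RPath m n u'' = StepOf (N ∷ u'') (m ∸ℕ 1) n
GPath m n ℓ' = StepOf (E ∷ ℓ') m n

-- Configurations on K_{m,n}: c i is the entry at vertex v_i (only
-- indices 1 .. n+m-1 are relevant; the sink v_{n+m} carries no entry).
Config : Set
Config = ℕ → ℤ

-- 'IsM m n u'' ℓ' y₁ y₂ c' : c = M(u'', ℓ', (y₁,y₂)), i.e.
--   c_{i+1}   = X₁(N_{y₂+i}) - y₁ - 1   (0 ≤ i ≤ n-1), and
--   c_{n+1+j} = X₂(E_{y₁+j}) - y₂ - 1   (0 ≤ j ≤ m-2),
-- where N_{y₂+i} is the (unique) north step of G starting at ordinate
-- y₂+i, with abscissa X₁, and E_{y₁+j} is the (unique) east step of R
-- starting at abscissa y₁+j, with ordinate X₂.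
IsM : ℕ → ℕ → Word → Word → ℤ → ℤ → Config → Set
IsM m n u'' ℓ' y₁ y₂ c =
  ((i : ℕ) → i <ℕ n →
     GPath m n ℓ' N (c (suc i) + y₁ + + 1) (y₂ + + i))
  × ((j : ℕ) → j <ℕ m ∸ℕ 1 →
     RPath m n u'' E (y₁ + + j) (c (suc (n +ℕ j)) + y₂ + + 1))

Sorted : ℕ → ℕ → Config → Set
Sorted m n c =
  ((i j : ℕ) → 1 ≤ℕ i → i ≤ℕ j → j ≤ℕ n → c i ≤ c j)
  × ((i j : ℕ) → suc n ≤ℕ i → i ≤ℕ j → j ≤ℕ n +ℕ (m ∸ℕ 1) → c i ≤ c j)

-- compact range: max_{i≤n} c_i - min_{i≤n} c_i ≤ m and
-- max_{n<i<n+m} c_i - min_{n<i<n+m} c_i ≤ n, written as: all pairwise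
-- differences within each block are bounded.
CompactRange : ℕ → ℕ → Config → Set
CompactRange m n c =
  ((i j : ℕ) → 1 ≤ℕ i → i ≤ℕ n → 1 ≤ℕ j → j ≤ℕ n → c i - c j ≤ + m)
  × ((i j : ℕ) → suc n ≤ℕ i → i ≤ℕ n +ℕ (m ∸ℕ 1) →
                 suc n ≤ℕ j → j ≤ℕ n +ℕ (m ∸ℕ 1) → c i - c j ≤ + n)

-- A periodic lattice path w^ℤ is a staircase: along it both coordinates are
-- non-decreasing, and among the steps of a fixed letter one coordinate is
-- strictly increasing.  Hence the abscissa of the north step at ordinate y is
-- monotone in y, which makes each block of M(u'', ℓ', y) sorted; and since
-- shifting a step by the period (p, q) gives again a step of the path, the
-- north steps at ordinates y ≤ y' ≤ y + q differ in abscissa by at most p,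
-- which is the compact range bound (p = m for G, and p = n, with the roles of
-- the coordinates exchanged, for R).
module Submission where

open import Defs
open import Data.Nat using (ℕ; _≥_; _∸_)
open import Data.Integer using (ℤ)
open import Data.Product using (_×_)

open import Data.Nat as ℕ using (zero; suc; z≤n; s≤s)
import Data.Nat.Properties as ℕ
open import Data.Integer using (+_; -_; _+_; _-_; _*_; _≤_; _<_; +≤+; +<+; 1ℤ) renaming (suc to sucℤ)
open import Data.Integer.Properties
open import Data.Integer.Tactic.RingSolver using (solve-∀)
open import Data.Fin using (Fin; toℕ) renaming (zero to fzero; suc to fsuc)
open import Data.List using ([]; _∷_; length; lookup; take; [_])
open import Data.Product using (∃; _,_)
open import Data.Product.Relation.Binary.Lex.Strict using (×-Lex)
open import Data.Sum using (_⊎_; inj₁; inj₂)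
open import Relation.Binary.Definitions using (tri<; tri≈; tri>)
open import Relation.Binary.PropositionalEquality using (_≡_; refl; sym; trans; cong; subst; subst₂)
open import Relation.Nullary using (yes; no; contradiction)

+-cancelʳ-≤ : ∀ k {i j} → i + k ≤ j + k → i ≤ j
+-cancelʳ-≤ k {i} {j} h = subst₂ _≤_ (cancel i) (cancel j) (+-monoˡ-≤ (- k) h)
  where
  cancel : ∀ x → x + k + - k ≡ x
  cancel x = trans (+-assoc x k (- k)) (trans (cong (_+_ x) (+-inverseʳ k)) (+-identityʳ x))

[i+k]-[j+k]≡i-j : ∀ i j k → (i + k) - (j + k) ≡ i - j
[i+k]-[j+k]≡i-j = solve-∀

i≤j+k⇒i-j≤k : ∀ {i j k} → i ≤ j + k → i - j ≤ k
i≤j+k⇒i-j≤k {i} {j} {k} h = subst (i - j ≤_) (cancel j k) (+-monoˡ-≤ (- j) h)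
  where
  cancel : ∀ j k → j + k - j ≡ k
  cancel = solve-∀

_≤lex_ : ℤ × ℕ → ℤ × ℕ → Set
_≤lex_ = ×-Lex _≡_ _<_ ℕ._≤_

≤lex⇒base-≤ : ∀ T {k k' a a'} → a ℕ.≤ T → (k , a) ≤lex (k' , a') →
  + T * k + + a ≤ + T * k' + + a'
≤lex⇒base-≤ T {k} a≤T (inj₂ (refl , a≤a')) = +-monoʳ-≤ (+ T * k) (+≤+ a≤a')
≤lex⇒base-≤ T {k} {k'} {a} {a'} a≤T (inj₁ k<k') = begin
  + T * k + + a    ≤⟨ +-monoʳ-≤ (+ T * k) (+≤+ a≤T) ⟩
  + T * k + + T    ≡⟨ trans (+-comm (+ T * k) (+ T)) (sym (*-suc (+ T) k)) ⟩
  + T * sucℤ k     ≤⟨ *-monoˡ-≤-nonNeg (+ T) (i<j⇒suc[i]≤j k<k') ⟩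
  + T * k'         ≤⟨ i≤i+j (+ T * k') (+ a') ⟩
  + T * k' + + a'  ∎
  where open ≤-Reasoning

≤lex-or->lex : ∀ k n k' n' → (k , n) ≤lex (k' , n') ⊎ (k' , suc n') ≤lex (k , n)
≤lex-or->lex k n k' n' with <-cmp k k'
... | tri< k<k' _ _ = inj₁ (inj₁ k<k')
... | tri> _ _ k>k' = inj₂ (inj₁ k>k')
... | tri≈ _ refl _ with n ℕ.≤? n'
...   | yes n≤n' = inj₁ (inj₂ (refl , n≤n'))
...   | no n≰n'  = inj₂ (inj₂ (refl , ℕ.≰⇒> n≰n'))

count-∷ : ∀ a x w → count a (x ∷ w) ≡ count a [ x ] ℕ.+ count a w
count-∷ N N w = refl
count-∷ N E w = refl
count-∷ E E w = refl
count-∷ E N w = refl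

count-take-≤ : ∀ a w n → count a (take n w) ℕ.≤ count a w
count-take-≤ a []      zero    = z≤n
count-take-≤ a []      (suc n) = z≤n
count-take-≤ a (x ∷ w) zero    = z≤n
count-take-≤ a (x ∷ w) (suc n)
  rewrite count-∷ a x (take n w) | count-∷ a x w =
  ℕ.+-monoʳ-≤ (count a [ x ]) (count-take-≤ a w n)

count-take-mono : ∀ a w {m n} → m ℕ.≤ n → count a (take m w) ℕ.≤ count a (take n w)
count-take-mono a []      {zero}  _ = z≤n
count-take-mono a []      {suc m} {suc n} _ = z≤n
count-take-mono a (x ∷ w) z≤n = z≤n
count-take-mono a (x ∷ w) {suc m} {suc n} (s≤s m≤n)
  rewrite count-∷ a x (take m w) | count-∷ a x (take n w) =
  ℕ.+-monoʳ-≤ (count a [ x ]) (count-take-mono a w m≤n)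

count-self : ∀ a w → count a (a ∷ w) ≡ suc (count a w)
count-self N w = refl
count-self E w = refl

count-take-lookup : ∀ {a} w (s : Fin (length w)) → lookup w s ≡ a →
  count a (take (toℕ s) w) ℕ.< count a (take (suc (toℕ s)) w)
count-take-lookup (x ∷ w) fzero    refl rewrite count-self x [] = ℕ.≤-refl
count-take-lookup {a} (x ∷ w) (fsuc s) ws≡a
  rewrite count-∷ a x (take (toℕ s) w) | count-∷ a x (take (suc (toℕ s)) w) =
  ℕ.+-monoʳ-< (count a [ x ]) (count-take-lookup w s ws≡a)

position : Word → Letter → ℤ → ℕ → ℤ
position w b k n = + count b w * k + + count b (take n w)

position-mono : ∀ w b {k k' n n'} → (k , n) ≤lex (k' , n') →
  position w b k n ≤ position w b k' n'
position-mono w b {n = n} k,n≤k',n' = ≤lex⇒base-≤ (count b w) (count-take-≤ b w n) (lift k,n≤k',n')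
  where
  lift : ∀ {k k' n n'} → (k , n) ≤lex (k' , n') →
    (k , count b (take n w)) ≤lex (k' , count b (take n' w))
  lift (inj₁ k<k')           = inj₁ k<k'
  lift (inj₂ (refl , n≤n')) = inj₂ (refl , count-take-mono b w n≤n')

position-lookup-< : ∀ w {a} k (s : Fin (length w)) → lookup w s ≡ a →
  position w a k (toℕ s) < position w a k (suc (toℕ s))
position-lookup-< w {a} k s ws≡a =
  +-monoʳ-< (+ count a w * k) (+<+ (count-take-lookup w s ws≡a))

-- The steps of letter a are totally ordered along the path by their
-- a-coordinate, so comparing that coordinate tells which comes first.
position-monotone : ∀ w {a} b k k' (s s' : Fin (length w)) → lookup w s' ≡ a →
  position w a k (toℕ s) ≤ position w a k' (toℕ s') →
  position w b k (toℕ s) ≤ position w b k' (toℕ s')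
position-monotone w {a} b k k' s s' ws'≡a h with ≤lex-or->lex k (toℕ s) k' (toℕ s')
... | inj₁ before = position-mono w b before
... | inj₂ after  = contradiction h
  (<⇒≱ (<-≤-trans (position-lookup-< w k' s' ws'≡a) (position-mono w a after)))

north-steps-monotone : ∀ w {p q x y x' y'} → InB p q w →
  StepOf w p q N x y → StepOf w p q N x' y' → y ≤ y' → x ≤ x'
north-steps-monotone w (refl , refl) (k , s , _ , refl , refl) (k' , s' , ws'≡N , refl , refl) =
  position-monotone w E k k' s s' ws'≡N

east-steps-monotone : ∀ w {p q x y x' y'} → InB p q w →
  StepOf w p q E x y → StepOf w p q E x' y' → x ≤ x' → y ≤ y'
east-steps-monotone w (refl , refl) (k , s , _ , refl , refl) (k' , s' , ws'≡E , refl , refl) =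
  position-monotone w N k k' s s' ws'≡E

StepOf-periodic : ∀ w {p q a x y} → StepOf w p q a x y → StepOf w p q a (x + + p) (y + + q)
StepOf-periodic w {p} {q} (k , s , ws≡a , refl , refl) =
  k + 1ℤ , s , ws≡a , next-copy (+ p) k _ , next-copy (+ q) k _
  where
  next-copy : ∀ t k c → t * k + c + t ≡ t * (k + 1ℤ) + c
  next-copy = solve-∀

InB-∷ : ∀ {p q} x w → InB p q w → InB (count E [ x ] ℕ.+ p) (count N [ x ] ℕ.+ q) (x ∷ w)
InB-∷ x w (refl , refl) = count-∷ E x w , count-∷ N x w

-- P x y: the staircase passes through value x at parameter y.
module Staircase {P : ℤ → ℤ → Set} (Δx Δy : ℕ)
  (monotone : ∀ {x y x' y'} → P x y → P x' y' → y ≤ y' → x ≤ x')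
  (periodic : ∀ {x y} → P x y → P (x + + Δx) (y + + Δy))
  where

  sorted : ∀ (f : ℕ → ℤ) b → (∀ i → i ℕ.< Δy → P (f i) (b + + i)) →
    ∀ {i j} → i ℕ.≤ j → j ℕ.< Δy → f i ≤ f j
  sorted f b onP i≤j j<Δy =
    monotone (onP _ (ℕ.≤-<-trans i≤j j<Δy)) (onP _ j<Δy) (+-monoʳ-≤ b (+≤+ i≤j))

  range : ∀ (f : ℕ → ℤ) b → (∀ i → i ℕ.< Δy → P (f i) (b + + i)) →
    ∀ {i j} → i ℕ.< Δy → j ℕ.< Δy → f i - f j ≤ + Δx
  range f b onP {i} {j} i<Δy j<Δy =
    i≤j+k⇒i-j≤k (monotone (onP i i<Δy) (periodic (onP j j<Δy)) i≤j+Δy)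
    where
    i≤j+Δy : b + + i ≤ b + + j + + Δy
    i≤j+Δy = subst (b + + i ≤_) (sym (+-assoc b (+ j) (+ Δy)))
      (+-monoʳ-≤ b (+≤+ (ℕ.≤-trans (ℕ.<⇒≤ i<Δy) (ℕ.m≤n+m Δy j))))

  block-index : ∀ o {i} → suc o ℕ.≤ i → i ℕ.≤ o ℕ.+ Δy → ∃ λ i' → i ≡ suc (o ℕ.+ i') × i' ℕ.< Δy
  block-index zero    {suc i} _           i≤Δy       = i , refl , i≤Δy
  block-index (suc o) {suc i} (s≤s o<i) (s≤s i≤o+Δy) with block-index o o<i i≤o+Δy
  ... | i' , refl , i'<Δy = i' , refl , i'<Δy

  module Block (c : Config) (o : ℕ) (a b : ℤ)
    (onP : ∀ i → i ℕ.< Δy → P (c (suc (o ℕ.+ i)) + a + 1ℤ) (b + + i))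
    where

    block-sorted : ∀ i j → suc o ℕ.≤ i → i ℕ.≤ j → j ℕ.≤ o ℕ.+ Δy → c i ≤ c j
    block-sorted i j o<i i≤j j≤o+Δy
      with block-index o o<i (ℕ.≤-trans i≤j j≤o+Δy) | block-index o (ℕ.≤-trans o<i i≤j) j≤o+Δy
    ... | i' , refl , _ | j' , refl , j'<Δy =
      +-cancelʳ-≤ a (+-cancelʳ-≤ 1ℤ
        (sorted _ b onP (ℕ.+-cancelˡ-≤ o i' j' (ℕ.≤-pred i≤j)) j'<Δy))

    block-range : ∀ i j → suc o ℕ.≤ i → i ℕ.≤ o ℕ.+ Δy → suc o ℕ.≤ j → j ℕ.≤ o ℕ.+ Δy →
      c i - c j ≤ + Δx
    block-range i j o<i i≤o+Δy o<j j≤o+Δy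
      with block-index o o<i i≤o+Δy | block-index o o<j j≤o+Δy
    ... | i' , refl , i'<Δy | j' , refl , j'<Δy = begin
      c i - c j                        ≡⟨ sym ([i+k]-[j+k]≡i-j (c i) (c j) a) ⟩
      (c i + a) - (c j + a)            ≡⟨ sym ([i+k]-[j+k]≡i-j (c i + a) (c j + a) 1ℤ) ⟩
      (c i + a + 1ℤ) - (c j + a + 1ℤ)  ≤⟨ range _ b onP i'<Δy j'<Δy ⟩
      + Δx                             ∎
      where open ≤-Reasoning

lemma5p5 : (m n : ℕ) → m ≥ 1 → n ≥ 1 →
    (u'' ℓ' : Word) → InB (m ∸ 1) (n ∸ 1) u'' → InB (m ∸ 1) n ℓ' →
    (y₁ y₂ : ℤ) → (c : Config) → IsM m n u'' ℓ' y₁ y₂ c →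
    Sorted m n c × CompactRange m n c
lemma5p5 m n m≥1 n≥1 u'' ℓ' u''∈B ℓ'∈B y₁ y₂ c (onG , onR) =
  (G.block-sorted , R.block-sorted) , (G.block-range , R.block-range)
  where
  Eℓ'∈B : InB m n (E ∷ ℓ')
  Eℓ'∈B = subst (λ p → InB p n (E ∷ ℓ')) (ℕ.m+[n∸m]≡n m≥1) (InB-∷ E ℓ' ℓ'∈B)

  Nu''∈B : InB (m ∸ 1) n (N ∷ u'')
  Nu''∈B = subst (λ q → InB (m ∸ 1) q (N ∷ u'')) (ℕ.m+[n∸m]≡n n≥1) (InB-∷ N u'' u''∈B)

  module G = Staircase.Block m n (north-steps-monotone (E ∷ ℓ') Eℓ'∈B) (StepOf-periodic (E ∷ ℓ'))
    c 0 y₁ y₂ onG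
  module R = Staircase.Block {λ x y → RPath m n u'' E y x} n (m ∸ 1)
    (east-steps-monotone (N ∷ u'') Nu''∈B) (StepOf-periodic (N ∷ u''))
    c n y₂ y₁ onR
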